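{- Let $n=p_1p_2\cdots p_k$ where $k\ge 2$ and $p_1<p_2<\dots<p_k$ are distinct primes. Then the zero-divisor graph $\Gamma(\mathbb{Z}_n)$ is not Hamiltonian.
   Context: For a finite commutative ring $R$ with unity, the zero-divisor graph $\Gamma(R)$ has vertex set the nonzero zero-divisors of $R$, with distinct $x,y$ adjacent iff $xy=0$. A graph of order $N$ is Hamiltonian if it contains a cycle of length $N$. -}

module Defs where

open import Data.Nat using (ℕ; zero; suc; _+_; _*_; _≤_; _<_)
open import Data.Nat.Divisibility using (_∣_)
open import Data.Nat.DivMod using (_mod_)
open import Data.Fin using (Fin; toℕ; fromℕ<; _≟_)
open import Data.Product using (Σ; _×_; ∃-syntax)
open import Relation.Nullary using (¬_)
open import Relation.Binary.PropositionalEquality using (_≡_)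
open import Function.Definitions using (Injective)

-- The ring ℤ_n is modelled on Fin n (residues 0,…,n-1).
-- Zero of ℤ_n: the residue 0; product of x and y is zero iff n ∣ x*y.
IsZero : ∀ {n} → Fin n → Set
IsZero x = toℕ x ≡ 0

MulZero : ∀ {n} → Fin n → Fin n → Set
MulZero {n} x y = n ∣ (toℕ x * toℕ y)

IsZeroDivisor : ∀ {n} → Fin n → Set
IsZeroDivisor {n} x = ∃[ y ] (¬ IsZero {n} y × MulZero x y)

IsVertex : ∀ {n} → Fin n → Set
IsVertex x = ¬ IsZero x × IsZeroDivisor x

Adj : ∀ {n} → Fin n → Fin n → Set
Adj x y = ¬ x ≡ y × MulZero x y

next : ∀ {N} → Fin (suc N) → Fin (suc N)
next {N} i = (suc (toℕ i)) mod (suc N)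

-- Γ(ℤ_n) is Hamiltonian: it has a cycle through all of its N vertices,
-- i.e. N ≥ 3 and an enumeration v : Fin N → vertices, bijective onto the
-- vertex set, with v i adjacent to v (i+1 mod N).
-- We write N = suc M.
IsHamiltonianZD : ℕ → Set
IsHamiltonianZD n =
  ∃[ M ] Σ (Fin (suc M) → Fin n) λ v →
      (3 ≤ suc M)
    × Injective _≡_ _≡_ v
    × (∀ i → IsVertex (v i))
    × (∀ x → IsVertex x → ∃[ i ] v i ≡ x)
    × (∀ i → Adj (v i) (v (next i)))

module Submission where

-- Write n = q · P · d with q < P the two smallest primes and
-- d ≥ 1 the product of the remaining ones.  Consider the q·d elements
--   x = q · (r + 1 + t·P)        (0 ≤ r < q, 0 ≤ t < d)
-- of ℤ_n.  They are pairwise distinct vertices of Γ(ℤ_n) (nonzero multiples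
-- of q, annihilated by P·d), and none of them is divisible by P.  Hence any
-- y adjacent to such an x satisfies P ∣ x·y, so P ∣ y: every neighbour of x
-- is a nonzero multiple of P, and ℤ_n has only q·d − 1 of those.  On a
-- Hamiltonian cycle, sending each vertex to its successor is injective, so
-- it would map q·d vertices injectively into a set of size q·d − 1 —
-- impossible by the pigeonhole principle.

open import Defs
open import Data.Nat using (ℕ; _<_; _≤_)
open import Data.Nat.Primality using (Prime)
open import Data.List using (List; length)
open import Data.Nat.ListAction using (product)
open import Data.List.Relation.Unary.All using (All)
open import Data.List.Relation.Unary.AllPairs using (AllPairs)
open import Relation.Nullary using (¬_)
open import Relation.Binary.PropositionalEquality using (_≡_)

open import Data.Nat using (suc; _+_; _*_; pred; s≤s; z<s; NonZero; >-nonZero; ≢-nonZero⁻¹; nonTrivial⇒n>1)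
open import Data.Nat.Properties
open import Data.Nat.DivMod using (_%_; [m+n]%n≡m%n; [m+kn]%n≡m%n; m<n⇒m%n≡m; %-distribˡ-+; m%n<n)
open import Data.Nat.Divisibility using (_∣_; divides; ∣-trans; n∣m*n; m∣m*n; >⇒∤; n∣m⇒m%n≡0)
open import Data.Nat.Primality using (euclidsLemma; prime⇒nonZero; prime⇒nonTrivial)
open import Data.Nat.ListAction.Properties using (product≢0)
open import Data.Fin using (Fin; toℕ; fromℕ<; remQuot; combine)
open import Data.Fin.Properties using (toℕ<n; toℕ-fromℕ<; toℕ-injective; injective⇒≤; combine-remQuot)
open import Data.Product using (_×_; _,_; proj₁; proj₂; ∃-syntax; uncurry)
open import Data.Sum using (inj₁; inj₂)
open import Data.List using (_∷_; [])
open import Data.List.Relation.Unary.All as All using (_∷_)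
open import Data.List.Relation.Unary.AllPairs using (_∷_)
open import Function.Definitions using (Injective)
open import Relation.Binary.PropositionalEquality using (refl; sym; trans; cong; cong₂; subst; subst₂; module ≡-Reasoning)
open import Relation.Nullary using (contradiction)

-- next i = (i + 1) mod N has the explicit left inverse k ↦ (k + (N − 1)) mod N.
next-retraction : ∀ {M} (i : Fin (suc M)) →
                  toℕ i ≡ (toℕ (next i) + M % suc M) % suc M
next-retraction {M} i = begin
  toℕ i                               ≡⟨ sym (m<n⇒m%n≡m (toℕ<n i)) ⟩
  toℕ i % N                           ≡⟨ sym ([m+n]%n≡m%n (toℕ i) N) ⟩
  (toℕ i + N) % N                     ≡⟨ cong (_% N) (+-suc (toℕ i) M) ⟩
  (suc (toℕ i) + M) % N               ≡⟨ %-distribˡ-+ (suc (toℕ i)) M N ⟩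
  (suc (toℕ i) % N + M % N) % N       ≡⟨ cong (λ k → (k + M % N) % N) (toℕ-fromℕ< (m%n<n (suc (toℕ i)) N)) ⟨
  (toℕ (next i) + M % N) % N          ∎
  where
  open ≡-Reasoning
  N = suc M

next-injective : ∀ {M} → Injective _≡_ _≡_ (next {M})
next-injective {M} {i} {j} eq = toℕ-injective (begin
  toℕ i                               ≡⟨ next-retraction i ⟩
  (toℕ (next i) + M % suc M) % suc M  ≡⟨ cong (λ k → (toℕ k + M % suc M) % suc M) eq ⟩
  (toℕ (next j) + M % suc M) % suc M  ≡⟨ next-retraction j ⟨
  toℕ j                               ∎)
  where open ≡-Reasoning

-- On a Hamiltonian cycle each vertex is followed by a neighbour, and distinct
-- vertices are followed by distinct ones.
distinctNeighbours : ∀ {n a} → IsHamiltonianZD n →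
                     (x : Fin a → Fin n) → Injective _≡_ _≡_ x → (∀ k → IsVertex (x k)) →
                     ∃[ y ] Injective _≡_ _≡_ y × (∀ k → ¬ IsZero (y k) × MulZero (x k) (y k))
distinctNeighbours {n} {a} (M , v , _ , v-inj , v-vertex , v-onto , v-adj) x x-inj x-vertex =
  y , y-inj , λ k → proj₁ (v-vertex (next (position k))) , annihilates k
  where
  position : Fin a → Fin (suc M)
  position k = proj₁ (v-onto (x k) (x-vertex k))
  at-position : ∀ k → v (position k) ≡ x k
  at-position k = proj₂ (v-onto (x k) (x-vertex k))
  y : Fin a → Fin n
  y k = v (next (position k))
  y-inj : Injective _≡_ _≡_ y
  y-inj {k} {l} eq = x-inj (begin
    x k              ≡⟨ at-position k ⟨
    v (position k)   ≡⟨ cong v (next-injective (v-inj eq)) ⟩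
    v (position l)   ≡⟨ at-position l ⟩
    x l              ∎)
    where open ≡-Reasoning
  annihilates : ∀ k → MulZero (x k) (y k)
  annihilates k = subst (λ z → MulZero z (y k)) (at-position k) (proj₂ (v-adj (position k)))

-- The nonzero multiples of P below m·P are P, 2P, …, (m − 1)P, so an injective
-- family of them has at most m − 1 members.
nonzeroMultiples-bound : ∀ {a n} P m → n ≡ m * P → (y : Fin a → Fin n) → Injective _≡_ _≡_ y →
                         (∀ k → P ∣ toℕ (y k)) → (∀ k → ¬ toℕ (y k) ≡ 0) → a ≤ pred m
nonzeroMultiples-bound {a} {n} P m n≡mP y y-inj P∣y y≢0 = injective⇒≤ index-inj
  where
  c : Fin a → ℕ
  c k = _∣_.quotient (P∣y k)
  y≡cP : ∀ k → toℕ (y k) ≡ c k * P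
  y≡cP k = _∣_.equality (P∣y k)
  1≤c : ∀ k → 1 ≤ c k
  1≤c k = n≢0⇒n>0 λ c≡0 → y≢0 k (trans (y≡cP k) (cong (_* P) c≡0))
  c<m : ∀ k → c k < m
  c<m k = *-cancelʳ-< P (c k) m (subst₂ _<_ (y≡cP k) n≡mP (toℕ<n (y k)))
  index : Fin a → Fin (pred m)
  index k = fromℕ< (∸-monoˡ-< (c<m k) (1≤c k))
  index-inj : Injective _≡_ _≡_ index
  index-inj {k} {l} eq = y-inj (toℕ-injective (begin
    toℕ (y k)  ≡⟨ y≡cP k ⟩
    c k * P    ≡⟨ cong (_* P) c-eq ⟩
    c l * P    ≡⟨ y≡cP l ⟨
    toℕ (y l)  ∎))
    where
    open ≡-Reasoning
    c-eq : c k ≡ c l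
    c-eq = ∸-cancelʳ-≡ (1≤c k) (1≤c l)
             (trans (sym (toℕ-fromℕ< _)) (trans (cong toℕ eq) (toℕ-fromℕ< _)))

prime∤* : ∀ {P u w} → Prime P → ¬ P ∣ u → ¬ P ∣ w → ¬ P ∣ u * w
prime∤* {P} {u} {w} pP P∤u P∤w P∣uw with euclidsLemma u w pP P∣uw
... | inj₁ P∣u = P∤u P∣u
... | inj₂ P∣w = P∤w P∣w

prime∣*-cancelˡ : ∀ {P u w} → Prime P → ¬ P ∣ u → P ∣ u * w → P ∣ w
prime∣*-cancelˡ {P} {u} {w} pP P∤u P∣uw with euclidsLemma u w pP P∣uw
... | inj₁ P∣u = contradiction P∣u P∤u
... | inj₂ P∣w = P∣w

-- In ℤ_{q·m} with q ≥ 2 and m ≠ 0, every nonzero multiple q·b is a vertex of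
-- the zero-divisor graph: the nonzero residue m annihilates it.
multiple-isVertex : ∀ q m b .{{_ : NonZero m}} .{{_ : NonZero b}} → 2 ≤ q →
                    (x : Fin (q * m)) → toℕ x ≡ q * b → IsVertex x
multiple-isVertex q m b 2≤q x x≡qb = x≢0 , annihilator , m≢0 , annihilates
  where
  instance
    q≢0 : NonZero q
    q≢0 = >-nonZero (<-trans z<s 2≤q)
  x≢0 : ¬ IsZero x
  x≢0 x≡0 = ≢-nonZero⁻¹ (q * b) {{m*n≢0 q b}} (trans (sym x≡qb) x≡0)
  annihilator : Fin (q * m)
  annihilator = fromℕ< (subst (m <_) (*-comm m q) (m<m*n m q 2≤q))
  m≢0 : ¬ IsZero annihilator
  m≢0 eq = ≢-nonZero⁻¹ m (trans (sym (toℕ-fromℕ< _)) eq)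
  annihilates : MulZero x annihilator
  annihilates = divides b (begin
    toℕ x * toℕ annihilator  ≡⟨ cong₂ _*_ x≡qb (toℕ-fromℕ< _) ⟩
    q * b * m                ≡⟨ *-assoc q b m ⟩
    q * (b * m)              ≡⟨ cong (q *_) (*-comm b m) ⟩
    q * (m * b)              ≡⟨ *-assoc q m b ⟨
    q * m * b                ≡⟨ *-comm (q * m) b ⟩
    b * (q * m)              ∎)
    where open ≡-Reasoning

-- The cofactors r + 1 + t·P (r < q, t < d).  Multiplied by q they give the
-- q·d vertices of Γ(ℤ_{q·P·d}) on which the counting argument runs.
cofactor : ∀ {d q} (P : ℕ) → Fin d → Fin q → ℕ
cofactor P t r = suc (toℕ r) + toℕ t * P

module _ {d q P : ℕ} .{{_ : NonZero P}} (q<P : q < P) where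

  -- Since r + 1 ≤ q < P, the cofactor leaves remainder r + 1 modulo P.
  cofactor-mod : ∀ (t : Fin d) (r : Fin q) → cofactor P t r % P ≡ suc (toℕ r)
  cofactor-mod t r = trans ([m+kn]%n≡m%n (suc (toℕ r)) (toℕ t) P)
                           (m<n⇒m%n≡m (<-≤-trans (s≤s (toℕ<n r)) q<P))

  cofactor-indivisible : ∀ (t : Fin d) (r : Fin q) → ¬ P ∣ cofactor P t r
  cofactor-indivisible t r P∣b = 0≢1+n (trans (sym (n∣m⇒m%n≡0 _ P P∣b)) (cofactor-mod t r))

  -- Uniqueness of division with remainder.
  cofactor-injective : ∀ (t t′ : Fin d) (r r′ : Fin q) →
                       cofactor P t r ≡ cofactor P t′ r′ → (t , r) ≡ (t′ , r′)
  cofactor-injective t t′ r r′ eq = cong₂ _,_ (toℕ-injective t≡t′) (toℕ-injective r≡r′)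
    where
    r≡r′ : toℕ r ≡ toℕ r′
    r≡r′ = suc-injective (trans (sym (cofactor-mod t r)) (trans (cong (_% P) eq) (cofactor-mod t′ r′)))
    t≡t′ : toℕ t ≡ toℕ t′
    t≡t′ = *-cancelʳ-≡ (toℕ t) (toℕ t′) P
             (+-cancelˡ-≡ (suc (toℕ r)) _ _ (trans eq (cong (λ s → suc s + toℕ t′ * P) (sym r≡r′))))

  cofactor-bound : ∀ (t : Fin d) (r : Fin q) → cofactor P t r < P * d
  cofactor-bound t r = begin-strict
    suc (toℕ r) + toℕ t * P  ≤⟨ +-monoˡ-≤ (toℕ t * P) (toℕ<n r) ⟩
    q + toℕ t * P            <⟨ +-monoˡ-< (toℕ t * P) q<P ⟩
    suc (toℕ t) * P          ≤⟨ *-monoˡ-≤ P (toℕ<n t) ⟩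
    d * P                    ≡⟨ *-comm d P ⟩
    P * d                    ∎
    where open ≤-Reasoning

indivisibleVertices : ∀ q P d → Prime q → Prime P → q < P → .{{_ : NonZero d}} →
                      ∃[ x ] Injective _≡_ _≡_ x × (∀ a → IsVertex (x a)) × (∀ a → ¬ P ∣ toℕ (x a))
indivisibleVertices q P d pq pP q<P = x , x-inj , x-vertex , P∤x
  where
  instance
    q≢0 : NonZero q
    q≢0 = prime⇒nonZero pq
    P≢0 : NonZero P
    P≢0 = prime⇒nonZero pP
    Pd≢0 : NonZero (P * d)
    Pd≢0 = m*n≢0 P d
  -- The index a ∈ Fin (d·q) encodes the pair (t , r) ∈ Fin d × Fin q.
  b : Fin (d * q) → ℕ
  b a = uncurry (cofactor P) (remQuot {d} q a)
  x : Fin (d * q) → Fin (q * (P * d))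
  x a = fromℕ< (*-monoʳ-< q (uncurry (cofactor-bound q<P) (remQuot {d} q a)))
  x≡qb : ∀ a → toℕ (x a) ≡ q * b a
  x≡qb a = toℕ-fromℕ< _
  x-inj : Injective _≡_ _≡_ x
  x-inj {a} {a′} eq = begin
    a                                   ≡⟨ combine-remQuot {d} q a ⟨
    uncurry combine (remQuot {d} q a)   ≡⟨ cong (uncurry combine) same-indices ⟩
    uncurry combine (remQuot {d} q a′)  ≡⟨ combine-remQuot {d} q a′ ⟩
    a′                                  ∎
    where
    open ≡-Reasoning
    same-indices : remQuot {d} q a ≡ remQuot {d} q a′
    same-indices = cofactor-injective q<P _ _ _ _
      (*-cancelˡ-≡ (b a) (b a′) q (trans (sym (x≡qb a)) (trans (cong toℕ eq) (x≡qb a′))))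
  x-vertex : ∀ a → IsVertex (x a)
  x-vertex a = multiple-isVertex q (P * d) (b a) (nonTrivial⇒n>1 q {{prime⇒nonTrivial pq}}) (x a) (x≡qb a)
  P∤x : ∀ a → ¬ P ∣ toℕ (x a)
  P∤x a = subst (λ z → ¬ P ∣ z) (sym (x≡qb a))
            (prime∤* pP (>⇒∤ q<P) (uncurry (cofactor-indivisible q<P) (remQuot {d} q a)))

-- The theorem for n = q·P·d with primes q < P and d ≠ 0: the cycle successors
-- of the q·d vertices above are neighbours, hence distinct nonzero multiples
-- of P, but there are only q·d − 1 of those.
noHamiltonianCycle : ∀ q P d → Prime q → Prime P → q < P → .{{_ : NonZero d}} →
                     ¬ IsHamiltonianZD (q * (P * d))
noHamiltonianCycle q P d pq pP q<P ham
  with indivisibleVertices q P d pq pP q<P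
... | x , x-inj , x-vertex , P∤x
  with distinctNeighbours ham x x-inj x-vertex
... | y , y-inj , y-neighbour =
  <-irrefl (*-comm d q) (m≤pred[n]⇒suc[m]≤n {{m*n≢0 q d {{prime⇒nonZero pq}}}} too-many)
  where
  n≡qdP : q * (P * d) ≡ q * d * P
  n≡qdP = trans (cong (q *_) (*-comm P d)) (sym (*-assoc q d P))
  P∣y : ∀ a → P ∣ toℕ (y a)
  P∣y a = prime∣*-cancelˡ pP (P∤x a) (∣-trans (∣-trans (m∣m*n d) (n∣m*n q)) (proj₂ (y-neighbour a)))
  too-many : d * q ≤ pred (q * d)
  too-many = nonzeroMultiples-bound P (q * d) n≡qdP y y-inj P∣y (λ a → proj₁ (y-neighbour a))

-- The two smallest primes play the roles of q < P; the others multiply to d ≠ 0.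
lemma2p5 : (n : ℕ) (ps : List ℕ) → All Prime ps → AllPairs _<_ ps →
           2 ≤ length ps → n ≡ product ps → ¬ IsHamiltonianZD n
lemma2p5 n (q ∷ P ∷ rest) (pq ∷ pP ∷ prest) ((q<P ∷ _) ∷ _) _ refl =
  noHamiltonianCycle q P (product rest) pq pP q<P {{product≢0 (All.map prime⇒nonZero prest)}}
lemma2p5 n (q ∷ []) _ _ (s≤s ()) _
lemma2p5 n [] _ _ () _
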